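{- Let $P=(X,\leq_P)$ be a finite poset with at least two points and no isolated points, and let $C=(Z,\leq_C)$ be a poset of height one which is the ordinal sum $L(C)\oplus U(C)$ of two antichains (i.e. $x<_C y$ iff $x\in L(C)$ and $y\in U(C)$). Then there exists a surjective order-preserving map from $P$ onto $C$ if and only if there exists a separating homomorphism from $\mathfrak{F}(P)$ to $\mathfrak{C}(C)$. Moreover, if $Z\subseteq E(P)$ and $C$ is the induced subposet of $P$ on $Z$, then $C$ is a retract of $P$ if and only if there exists a $Z$-separating homomorphism from $\mathfrak{F}(P)$ to $\mathfrak{C}(C)$.
   Context: Posets: for $P=(X,\leq_P)$, $L(P)$, $U(P)$ are the minimal and maximal points, $E(P):=L(P)\cup U(P)$; ${\downarrow}_P y:=\{x: x\leq_P y\}$, ${\uparrow}_P y:=\{x:y\leq_P x\}$, $[x,y]_P:={\uparrow}_P x\cap{\downarrow}_P y$; subsets are identified with induced subposets. A retract of $P$ is the image of an idempotent order-preserving map $r:P\to P$. A 4-crown in $P$ is a set $\{a,b,v,w\}$ with $a,b<_P v,w$, $a\parallel b$, $v\parallel w$; its inner is $[a,v]_P\cap[b,w]_P$, and it is improper if the inner is nonempty. 4-crown bundles: $\mathcal{C}_{imp}(P)$ is the set of improper 4-crowns contained in $E(P)$; $\mathcal{M}(P)$ is the union of the inners of all members of $\mathcal{C}_{imp}(P)$; for $m\in\mathcal{M}(P)$, $\Xi(m) := (L(P)\cap{\downarrow}_P m)\cup(U(P)\cap{\uparrow}_P m)$; $\mathcal{F}(P)$ is the set of inclusion-maximal members of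 $\{\Xi(m): m\in\mathcal{M}(P)\}$. $\mathfrak{F}(P)$ is the multigraph with vertex set $\mathcal{F}(P)$ having an L-edge between $F,G$ (loops allowed) iff $L(P)\cap F\cap G\neq\emptyset$ and a U-edge iff $U(P)\cap F\cap G\neq\emptyset$. For $C$ of height one with carrier $Z=L(C)\cup U(C)$: for $a\in L(C)$, $\curlyvee(a):=\{\{a\}\cup N:\emptyset\neq N\subseteq U(C)\}$, $\mathcal{L}:=\bigcup_{a\in L(C)}\curlyvee(a)$; for $v\in U(C)$, $\curlywedge(v):=\{\{v\}\cup N:\emptyset\neq N\subseteq L(C)\}$, $\mathcal{U}:=\bigcup_{v\in U(C)}\curlywedge(v)$. $\mathcal{C}_0(C):=\{S\in\mathcal{L}:\exists a\in L(C),\ S\subseteq{\uparrow}_C a\}\cup\{S\in\mathcal{U}:\exists v\in U(C),\ S\subseteq{\downarrow}_C v\}$. $\mathfrak{C}(C)$ is the multigraph with vertex set $\mathcal{C}_0(C)$ having an L-edge between $S,T$ iff $L(C)\cap S\cap T\neq\emptyset$ and a U-edge iff $U(C)\cap S\cap T\neq\emptyset$. A homomorphism $\phi:\mathfrak{F}(P)\to\mathfrak{C}(C)$ is a map $\mathcal{F}(P)\to\mathcal{C}_0(C)$ such that an L-edge (U-edge) between $F$ and $G$ implies an L-edge (U-edge) between $\phi(F)$ and $\phi(G)$. It is separating if there is an injective $i:Z\to E(P)$ with $i[L(C)]\subseteq L(P)$, $i[U(C)]\subseteq U(P)$ such that for all $a\in L(C)$, $v\in U(C)$, $F\in\mathcal{F}(P)$: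 ($i(a)\in F$ and $\phi(F)\in\mathcal{L}$) implies $\phi(F)\in\curlyvee(a)$, and ($i(v)\in F$ and $\phi(F)\in\mathcal{U}$) implies $\phi(F)\in\curlywedge(v)$; such $i$ is said to belong to $\phi$. $\phi$ is $Z$-separating if $Z\subseteq E(P)$ and the belonging $i$ satisfies $i[Z]=Z$. -}

module Defs where

open import Data.Nat using (ℕ)
open import Data.Fin using (Fin)
open import Data.Fin.Subset using (Subset; _∈_; ⁅_⁆; _∪_; Nonempty)
open import Data.Product using (Σ; ∃; ∃-syntax; _×_; _,_)
open import Data.Sum using (_⊎_)
open import Relation.Binary.PropositionalEquality using (_≡_; _≢_)
open import Relation.Binary.Structures using (IsPartialOrder)
open import Relation.Binary.Definitions using (Decidable)
open import Relation.Nullary using (¬_)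
open import Function.Definitions using (Injective)
open import Function.Bundles using (_⇔_)

record FinPoset : Set₁ where
  field
    size           : ℕ
    _≼_            : Fin size → Fin size → Set
    isPartialOrder : IsPartialOrder _≡_ _≼_
    _≼?_           : Decidable _≼_

open FinPoset public

module _ (P : FinPoset) where
  private
    X = Fin (size P)
    _≤_ = _≼_ P

  Lt : X → X → Set
  Lt x y = x ≤ y × x ≢ y

  Incomp : X → X → Set
  Incomp x y = ¬ (x ≤ y) × ¬ (y ≤ x)

  IsMin : X → Set
  IsMin x = ∀ y → y ≤ x → y ≡ x

  IsMax : X → Set
  IsMax x = ∀ y → x ≤ y → y ≡ x

  IsExt : X → Set
  IsExt x = IsMin x ⊎ IsMax x

  NoIsolated : Set
  NoIsolated = ∀ x → ∃[ y ] (y ≢ x × (x ≤ y ⊎ y ≤ x))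

  Is4Crown : X → X → X → X → Set
  Is4Crown a b v w =
    Lt a v × Lt a w × Lt b v × Lt b w × Incomp a b × Incomp v w

  InInner : X → X → X → X → X → Set
  InInner a b v w m = (a ≤ m × m ≤ v) × (b ≤ m × m ≤ w)

  InCimp : X → X → X → X → Set
  InCimp a b v w =
    Is4Crown a b v w × (IsExt a × IsExt b × IsExt v × IsExt w)
    × ∃[ m ] InInner a b v w m

  InM : X → Set
  InM m = ∃[ a ] ∃[ b ] ∃[ v ] ∃[ w ] (InCimp a b v w × InInner a b v w m)

  Xi : X → X → Set
  Xi m x = (IsMin x × x ≤ m) ⊎ (IsMax x × m ≤ x)

  InF : Subset (size P) → Set
  InF F = ∃[ m ] (InM m × (∀ x → (x ∈ F) ⇔ Xi m x)
                  × (∀ m' → InM m' → (∀ x → Xi m x → Xi m' x)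
                                   → (∀ x → Xi m' x → Xi m x)))

  LEdge : Subset (size P) → Subset (size P) → Set
  LEdge S T = ∃[ x ] (IsMin x × x ∈ S × x ∈ T)

  UEdge : Subset (size P) → Subset (size P) → Set
  UEdge S T = ∃[ x ] (IsMax x × x ∈ S × x ∈ T)

  InCurlyVee : X → Subset (size P) → Set
  InCurlyVee a S = ∃[ N ] (Nonempty N × (∀ x → x ∈ N → IsMax x) × S ≡ ⁅ a ⁆ ∪ N)

  InCurlyWedge : X → Subset (size P) → Set
  InCurlyWedge v S = ∃[ N ] (Nonempty N × (∀ x → x ∈ N → IsMin x) × S ≡ ⁅ v ⁆ ∪ N)

  InCalL : Subset (size P) → Set
  InCalL S = ∃[ a ] (IsMin a × InCurlyVee a S)

  InCalU : Subset (size P) → Set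
  InCalU S = ∃[ v ] (IsMax v × InCurlyWedge v S)

  InC0 : Subset (size P) → Set
  InC0 S = (InCalL S × ∃[ a ] (IsMin a × (∀ x → x ∈ S → a ≤ x)))
         ⊎ (InCalU S × ∃[ v ] (IsMax v × (∀ x → x ∈ S → x ≤ v)))

  HeightOne : Set
  HeightOne = (∃[ x ] ∃[ y ] Lt x y) × ¬ (∃[ x ] ∃[ y ] ∃[ z ] (Lt x y × Lt y z))

  OrdinalSumLU : Set
  OrdinalSumLU = ∀ x y → Lt x y ⇔ (IsMin x × IsMax y)

module _ (P C : FinPoset) where
  private
    X = Fin (size P)
    Z = Fin (size C)

  Monotone : (X → Z) → Set
  Monotone f = ∀ x y → _≼_ P x y → _≼_ C (f x) (f y)

  SurjectiveMonotone : Set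
  SurjectiveMonotone = ∃[ f ] (Monotone f × (∀ z → ∃[ x ] f x ≡ z))

  -- φ : 𝔉(P) → ℭ(C) is a homomorphism (φ given as a total function on
  -- subsets, only its values on 𝓕(P) matter)
  IsHom : (Subset (size P) → Subset (size C)) → Set
  IsHom φ =
      (∀ F → InF P F → InC0 C (φ F))
    × (∀ F G → InF P F → InF P G → LEdge P F G → LEdge C (φ F) (φ G))
    × (∀ F G → InF P F → InF P G → UEdge P F G → UEdge C (φ F) (φ G))

  Belongs : (Subset (size P) → Subset (size C)) → (Z → X) → Set
  Belongs φ i =
      Injective _≡_ _≡_ i
    × (∀ a → IsMin C a → IsMin P (i a))
    × (∀ v → IsMax C v → IsMax P (i v))
    × (∀ a F → IsMin C a → InF P F → i a ∈ F → InCalL C (φ F) → InCurlyVee C a (φ F))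
    × (∀ v F → IsMax C v → InF P F → i v ∈ F → InCalU C (φ F) → InCurlyWedge C v (φ F))

  Separating : (Subset (size P) → Subset (size C)) → Set
  Separating φ = ∃[ i ] Belongs φ i

  -- Z ⊆ E(P) is given by the embedding e : Z → X; Z-separating means some
  -- belonging i has i[Z] = e[Z]
  ZSeparating : (Z → X) → (Subset (size P) → Subset (size C)) → Set
  ZSeparating e φ =
    (∀ z → IsExt P (e z))
    × ∃[ i ] (Belongs φ i × (∀ z → ∃[ z' ] i z ≡ e z') × (∀ z → ∃[ z' ] i z' ≡ e z))

  -- C (identified with Z = e[Z] ⊆ X) is a retract of P
  IsRetractVia : (Z → X) → Set
  IsRetractVia e = Σ (X → X) λ r → ((∀ x y → _≼_ P x y → _≼_ P (r x) (r y))
                          × (∀ x → r (r x) ≡ r x)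
                          × (∀ x → ∃[ z ] r x ≡ e z)
                          × (∀ z → ∃[ x ] r x ≡ e z))

  InducedEmbedding : (Z → X) → Set
  InducedEmbedding e = Injective _≡_ _≡_ e
                     × (∀ x y → _≼_ C x y ⇔ _≼_ P (e x) (e y))

{-# OPTIONS --safe #-}
module Submission where

-- Forward: correct a surjective monotone f : P → C so that it sends L(P) into L(C) and U(P) into
-- U(C). Since C is an ordinal sum, this map sends each bundle Ξ(m) ∈ 𝓕(P) onto ⋎(f m) or ⋏(f m), a
-- member of 𝓒₀(C). Edges are preserved because shared points have shared images, and choosing
-- preimages among the extremal points of P gives a separating injection.
--
-- Backward: a separating homomorphism φ with injection i gives each minimal point x a label in L(C):
-- i⁻¹ x on i[L(C)], and otherwise the bottom of φ F for some bundle F ∋ x. L-edges make this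
-- independent of F. Maximal points get labels in U(C) in the same way. No point m has both two
-- differently labelled minimal points below it and two differently labelled maximal points above it:
-- those four points would be an improper 4-crown around m, and the image of the bundle containing
-- them is a star that forces one of the two pairs of labels to agree. So m can be sent to the common
-- label below it or above it. This gives a monotone map with i as a section. For retracts, the
-- same constructions apply with i = e up to a permutation of C.

open import Defs
open import Data.Nat using (_≤_)
open import Data.Fin using (Fin; _≟_)
open import Data.Fin.Properties using (any?; all?)
open import Data.Fin.Induction using (spo-wellFounded)
open import Data.Fin.Subset using (Subset; _∈_; ⁅_⁆; _∪_; _∩_; Nonempty)
open import Data.Fin.Subset.Properties
  using ( _∈?_; anySubset?; ⊆-antisym; x∈⁅x⁆; x∈⁅y⁆⇒x≡y
        ; x∈p∪q⁺; x∈p∪q⁻; x∈p∩q⁺; x∈p∩q⁻)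
open import Data.Vec using (tabulate)
open import Data.Vec.Properties using (lookup∘tabulate; []=⇒lookup; lookup⇒[]=)
open import Data.Bool.Properties using (T-≡)
open import Data.Product using (Σ; ∃; ∃-syntax; _×_; _,_; proj₁; proj₂)
open import Data.Sum using (_⊎_; inj₁; inj₂)
open import Data.Empty using (⊥; ⊥-elim)
open import Function using (_∘_; flip)
open import Function.Bundles using (_⇔_; mk⇔; Equivalence)
open import Induction.WellFounded using (Acc; acc)
open import Level using (0ℓ)
open import Relation.Binary.Core using (Rel)
open import Relation.Binary.Definitions using (Decidable)
open import Relation.Binary.Structures using (IsPartialOrder; IsStrictPartialOrder)
open import Relation.Binary.PropositionalEquality
  using (_≡_; _≢_; refl; sym; trans; cong; subst; subst₂; isEquivalence; module ≡-Reasoning)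
import Relation.Binary.Construct.NonStrictToStrict as ToStrict
import Relation.Binary.Construct.Flip.EqAndOrd as Flip
open import Relation.Nullary using (¬_; Dec; yes; no; does)
open import Relation.Nullary.Decidable
  using (_×-dec_; _⊎-dec_; _→-dec_; ¬?; map′; toWitness; isYes≗does; dec-true; decidable-stable)
import Relation.Unary as U

subsetOf : ∀ {n} {Q : U.Pred (Fin n) 0ℓ} → U.Decidable Q → Subset n
subsetOf Q? = tabulate (does ∘ Q?)

∈-subsetOf : ∀ {n} {Q : U.Pred (Fin n) 0ℓ} (Q? : U.Decidable Q) {x} → x ∈ subsetOf Q? ⇔ Q x
∈-subsetOf Q? {x} = mk⇔
  (λ x∈ → toWitness {a? = Q? x} (Equivalence.from T-≡
    (trans (isYes≗does (Q? x)) (trans (sym (lookup∘tabulate _ x)) ([]=⇒lookup x∈)))))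
  (λ q → lookup⇒[]= x _ (trans (lookup∘tabulate _ x) (dec-true (Q? x) q)))

image : ∀ {m n} → (Fin m → Fin n) → Subset m → Subset n
image g F = subsetOf (λ z → any? (λ x → (x ∈? F) ×-dec (g x ≟ z)))

module _ {m n} (g : Fin m → Fin n) where
  ∈-image⁺ : ∀ {F x} → x ∈ F → g x ∈ image g F
  ∈-image⁺ {F} x∈F =
    Equivalence.from (∈-subsetOf (λ z → any? (λ x → (x ∈? F) ×-dec (g x ≟ z)))) (_ , x∈F , refl)

  ∈-image⁻ : ∀ {F z} → z ∈ image g F → ∃[ x ] (x ∈ F × g x ≡ z)
  ∈-image⁻ {F} = Equivalence.to (∈-subsetOf (λ z → any? (λ x → (x ∈? F) ×-dec (g x ≟ z))))

  module _ {Q : U.Pred (Fin m) 0ℓ} (Q? : U.Decidable Q) where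
    ∈-image-∩⁺ : ∀ {F x} → x ∈ F → Q x → g x ∈ image g (F ∩ subsetOf Q?)
    ∈-image-∩⁺ x∈F q = ∈-image⁺ (x∈p∩q⁺ (x∈F , Equivalence.from (∈-subsetOf Q?) q))

    ∈-image-∩⁻ : ∀ {F z} → z ∈ image g (F ∩ subsetOf Q?) → ∃[ x ] ((x ∈ F × Q x) × g x ≡ z)
    ∈-image-∩⁻ {F} z∈ with ∈-image⁻ z∈
    ... | x , x∈ , gx≡z = let (x∈F , x∈Q) = x∈p∩q⁻ F _ x∈ in
                          x , (x∈F , Equivalence.to (∈-subsetOf Q?) x∈Q) , gx≡z

_⇔?_ : ∀ {A B : Set} → Dec A → Dec B → Dec (A ⇔ B)
a? ⇔? b? = map′ (λ (f , g) → mk⇔ f g) (λ e → Equivalence.to e , Equivalence.from e)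
                ((a? →-dec b?) ×-dec (b? →-dec a?))

module _ {n} {_<_ : Rel (Fin n) 0ℓ} (isSPO : IsStrictPartialOrder _≡_ _<_) (_<?_ : Decidable _<_) where
  open IsStrictPartialOrder isSPO using () renaming (trans to <-trans)

  minimal-below : ∀ x → ∃[ a ] ((a ≡ x ⊎ a < x) × (∀ y → ¬ y < a))
  minimal-below x = go x (spo-wellFounded isSPO x)
    where
    go : ∀ x → Acc _<_ x → ∃[ a ] ((a ≡ x ⊎ a < x) × (∀ y → ¬ y < a))
    go x (acc below) with any? (λ y → y <? x)
    ... | no none = x , inj₁ refl , λ y y<x → none (y , y<x)
    ... | yes (y , y<x) with go y (below y<x)
    ...   | a , inj₁ refl , min = a , inj₂ y<x , min
    ...   | a , inj₂ a<y , min = a , inj₂ (<-trans a<y y<x) , min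

module PosetFacts (P : FinPoset) where
  private
    X = Fin (size P)
    _⊑_ = _≼_ P
    _⊑?_ = _≼?_ P

  open IsPartialOrder (isPartialOrder P) public
    using () renaming (reflexive to ⊑-reflexive; trans to ⊑-trans)

  IsMin? : U.Decidable (IsMin P)
  IsMin? x = all? (λ y → (y ⊑? x) →-dec (y ≟ x))

  IsMax? : U.Decidable (IsMax P)
  IsMax? x = all? (λ y → (x ⊑? y) →-dec (y ≟ x))

  Lt? : Decidable (Lt P)
  Lt? = ToStrict.<-decidable _≡_ _⊑_ _≟_ _⊑?_

  Lt-isStrictPartialOrder : IsStrictPartialOrder _≡_ (Lt P)
  Lt-isStrictPartialOrder = ToStrict.<-isStrictPartialOrder _≡_ _⊑_ (isPartialOrder P)

  InInner? : ∀ a b v w m → Dec (InInner P a b v w m)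
  InInner? a b v w m = ((a ⊑? m) ×-dec (m ⊑? v)) ×-dec ((b ⊑? m) ×-dec (m ⊑? w))

  InCimp? : ∀ a b v w → Dec (InCimp P a b v w)
  InCimp? a b v w =
    crown? ×-dec (ext? a ×-dec ext? b ×-dec ext? v ×-dec ext? w) ×-dec any? (InInner? a b v w)
    where
    ext? : U.Decidable (IsExt P)
    ext? x = IsMin? x ⊎-dec IsMax? x
    incomp? : Decidable (Incomp P)
    incomp? x y = ¬? (x ⊑? y) ×-dec ¬? (y ⊑? x)
    crown? : Dec (Is4Crown P a b v w)
    crown? = Lt? a v ×-dec Lt? a w ×-dec Lt? b v ×-dec Lt? b w ×-dec incomp? a b ×-dec incomp? v w

  InM? : U.Decidable (InM P)
  InM? m = any? λ a → any? λ b → any? λ v → any? λ w → InCimp? a b v w ×-dec InInner? a b v w m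

  Xi? : Decidable (Xi P)
  Xi? m x = (IsMin? x ×-dec (x ⊑? m)) ⊎-dec (IsMax? x ×-dec (m ⊑? x))

  _⊆Ξ_ : Rel X 0ℓ
  m ⊆Ξ m' = ∀ x → Xi P m x → Xi P m' x

  _⊆Ξ?_ : Decidable _⊆Ξ_
  m ⊆Ξ? m' = all? (λ x → Xi? m x →-dec Xi? m' x)

  IsMaximalInM : U.Pred X 0ℓ
  IsMaximalInM m = ∀ m' → InM P m' → m ⊆Ξ m' → m' ⊆Ξ m

  InF? : U.Decidable (InF P)
  InF? F = any? λ m → InM? m ×-dec all? (λ x → (x ∈? F) ⇔? Xi? m x)
                            ×-dec all? (λ m' → InM? m' →-dec ((m ⊆Ξ? m') →-dec (m' ⊆Ξ? m)))

  min-below : ∀ x → ∃[ a ] (IsMin P a × a ⊑ x)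
  min-below x with minimal-below Lt-isStrictPartialOrder Lt? x
  ... | a , a≤x , none-below = a , a-min , ≤⇒⊑ a≤x
    where
    a-min : IsMin P a
    a-min y y⊑a = decidable-stable (y ≟ a) (λ y≢a → none-below y (y⊑a , y≢a))
    ≤⇒⊑ : a ≡ x ⊎ Lt P a x → a ⊑ x
    ≤⇒⊑ (inj₁ a≡x) = ⊑-reflexive a≡x
    ≤⇒⊑ (inj₂ a<x) = proj₁ a<x

  max-above : ∀ x → ∃[ v ] (IsMax P v × x ⊑ v)
  max-above x with minimal-below (Flip.isStrictPartialOrder Lt-isStrictPartialOrder) (flip Lt?) x
  ... | v , v≥x , none-above = v , v-max , ≥⇒⊑ v≥x
    where
    v-max : IsMax P v
    v-max y v⊑y = decidable-stable (y ≟ v) (λ y≢v → none-above y (v⊑y , y≢v ∘ sym))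
    ≥⇒⊑ : v ≡ x ⊎ Lt P x v → x ⊑ v
    ≥⇒⊑ (inj₁ v≡x) = ⊑-reflexive (sym v≡x)
    ≥⇒⊑ (inj₂ x<v) = proj₁ x<v

  _⊂Ξ_ : Rel X 0ℓ
  m ⊂Ξ m' = InM P m' × m ⊆Ξ m' × ∃[ x ] (Xi P m' x × ¬ Xi P m x)

  _⊂Ξ?_ : Decidable _⊂Ξ_
  m ⊂Ξ? m' = InM? m' ×-dec (m ⊆Ξ? m') ×-dec any? (λ x → Xi? m' x ×-dec ¬? (Xi? m x))

  ⊂Ξ-isStrictPartialOrder : IsStrictPartialOrder _≡_ _⊂Ξ_
  ⊂Ξ-isStrictPartialOrder = record
    { isEquivalence = isEquivalence
    ; irrefl = λ { refl (_ , _ , x , x∈ , x∉) → x∉ x∈ }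
    ; trans = λ (_ , ⊆₁ , _) (m″∈M , ⊆₂ , x , x∈ , x∉) →
                m″∈M , (λ y → ⊆₂ y ∘ ⊆₁ y) , x , x∈ , x∉ ∘ ⊆₁ x
    ; <-resp-≈ = (λ { refl r → r }) , (λ { refl r → r })
    }

  ⊂Ξ-top⇒maximal : ∀ {m} → (∀ m' → ¬ m ⊂Ξ m') → IsMaximalInM m
  ⊂Ξ-top⇒maximal {m} top m' m'∈M m⊆m' x x∈ =
    decidable-stable (Xi? m x) (λ x∉ → top m' (m'∈M , m⊆m' , x , x∈ , x∉))

  maximal-Ξ-above : ∀ {m} → InM P m → ∃[ m* ] (InM P m* × m ⊆Ξ m* × IsMaximalInM m*)
  maximal-Ξ-above {m} m∈M
    with minimal-below (Flip.isStrictPartialOrder ⊂Ξ-isStrictPartialOrder) (flip _⊂Ξ?_) m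
  ... | m* , inj₁ refl , top = m* , m∈M , (λ _ p → p) , ⊂Ξ-top⇒maximal top
  ... | m* , inj₂ (m*∈M , m⊆m* , _) , top = m* , m*∈M , m⊆m* , ⊂Ξ-top⇒maximal top

  InM⇒bundle : ∀ {m} → InM P m → ∃[ F ] (InF P F × ∀ x → Xi P m x → x ∈ F)
  InM⇒bundle m∈M with maximal-Ξ-above m∈M
  ... | m* , m*∈M , m⊆m* , maximal =
    subsetOf (Xi? m*) , (m* , m*∈M , (λ _ → ∈-subsetOf (Xi? m*)) , maximal)
    , λ x x∈ → Equivalence.from (∈-subsetOf (Xi? m*)) (m⊆m* x x∈)

  module _ {k} (ℓ : X → Fin k) where
    SplitsBelow : U.Pred X 0ℓ
    SplitsBelow m = ∃[ x ] ∃[ x' ] ((IsMin P x × x ⊑ m) × (IsMin P x' × x' ⊑ m) × ℓ x ≢ ℓ x')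

    SplitsAbove : U.Pred X 0ℓ
    SplitsAbove m = ∃[ y ] ∃[ y' ] ((IsMax P y × m ⊑ y) × (IsMax P y' × m ⊑ y') × ℓ y ≢ ℓ y')

    SplitsBelow? : U.Decidable SplitsBelow
    SplitsBelow? m = any? λ x → any? λ x' →
      (IsMin? x ×-dec (x ⊑? m)) ×-dec (IsMin? x' ×-dec (x' ⊑? m)) ×-dec ¬? (ℓ x ≟ ℓ x')

    ¬SplitsBelow⇒const : ∀ {m x x'} → ¬ SplitsBelow m →
                         IsMin P x → x ⊑ m → IsMin P x' → x' ⊑ m → ℓ x ≡ ℓ x'
    ¬SplitsBelow⇒const ¬split x-min x⊑m x'-min x'⊑m = decidable-stable (ℓ _ ≟ ℓ _)
      (λ ℓx≢ℓx' → ¬split (_ , _ , (x-min , x⊑m) , (x'-min , x'⊑m) , ℓx≢ℓx'))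

    ¬SplitsAbove⇒const : ∀ {m y y'} → ¬ SplitsAbove m →
                         IsMax P y → m ⊑ y → IsMax P y' → m ⊑ y' → ℓ y ≡ ℓ y'
    ¬SplitsAbove⇒const ¬split y-max m⊑y y'-max m⊑y' = decidable-stable (ℓ _ ≟ ℓ _)
      (λ ℓy≢ℓy' → ¬split (_ , _ , (y-max , m⊑y) , (y'-max , m⊑y') , ℓy≢ℓy'))

    SplitsBelow-mono : ∀ {m m'} → m ⊑ m' → SplitsBelow m → SplitsBelow m'
    SplitsBelow-mono m⊑m' (x , x' , (x-min , x⊑m) , (x'-min , x'⊑m) , ℓx≢ℓx') =
      x , x' , (x-min , ⊑-trans x⊑m m⊑m') , (x'-min , ⊑-trans x'⊑m m⊑m') , ℓx≢ℓx'

    min⇒¬SplitsBelow : ∀ {m} → IsMin P m → ¬ SplitsBelow m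
    min⇒¬SplitsBelow m-min (x , x' , (_ , x⊑m) , (_ , x'⊑m) , ℓx≢ℓx') =
      ℓx≢ℓx' (cong ℓ (trans (m-min x x⊑m) (sym (m-min x' x'⊑m))))

  module _ (noIso : NoIsolated P) where
    min-max-disjoint : ∀ {x} → IsMin P x → IsMax P x → ⊥
    min-max-disjoint {x} x-min x-max with noIso x
    ... | y , y≢x , inj₁ x⊑y = y≢x (x-max y x⊑y)
    ... | y , y≢x , inj₂ y⊑x = y≢x (x-min y y⊑x)

    min<max : ∀ {a v} → IsMin P a → IsMax P v → a ⊑ v → Lt P a v
    min<max a-min v-max a⊑v = a⊑v , λ { refl → min-max-disjoint a-min v-max }

    splits⇒InM : ∀ {k k'} {ℓ : X → Fin k} {ℓ' : X → Fin k'} {m} →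
                 SplitsBelow ℓ m → SplitsAbove ℓ' m → InM P m
    splits⇒InM {ℓ = ℓ} {ℓ'} {m}
      (x , x' , (x-min , x⊑m) , (x'-min , x'⊑m) , ℓx≢ℓx')
      (y , y' , (y-max , m⊑y) , (y'-max , m⊑y') , ℓ'y≢ℓ'y') =
      x , x' , y , y' , (crown , extremal , m , inner) , inner
      where
      lt : ∀ {a v} → IsMin P a → a ⊑ m → IsMax P v → m ⊑ v → Lt P a v
      lt a-min a⊑m v-max m⊑v = min<max a-min v-max (⊑-trans a⊑m m⊑v)
      crown : Is4Crown P x x' y y'
      crown = lt x-min x⊑m y-max m⊑y , lt x-min x⊑m y'-max m⊑y'
            , lt x'-min x'⊑m y-max m⊑y , lt x'-min x'⊑m y'-max m⊑y'
            , ( (λ x⊑x' → ℓx≢ℓx' (cong ℓ (x'-min x x⊑x')))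
              , (λ x'⊑x → ℓx≢ℓx' (cong ℓ (sym (x-min x' x'⊑x)))))
            , ( (λ y⊑y' → ℓ'y≢ℓ'y' (cong ℓ' (sym (y-max y' y⊑y'))))
              , (λ y'⊑y → ℓ'y≢ℓ'y' (cong ℓ' (y'-max y y'⊑y))))
      extremal : IsExt P x × IsExt P x' × IsExt P y × IsExt P y'
      extremal = inj₁ x-min , inj₁ x'-min , inj₂ y-max , inj₂ y'-max
      inner : InInner P x x' y y' m
      inner = (x⊑m , m⊑y) , (x'⊑m , m⊑y')

module OrdinalSumFacts (C : FinPoset) (h1 : HeightOne C) (os : OrdinalSumLU C) where
  private
    Z = Fin (size C)
    _⊑_ = _≼_ C
    _⊑?_ = _≼?_ C
  open PosetFacts C using (IsMin?; IsMax?; Lt?; ⊑-reflexive)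

  min⊑max : ∀ {a v} → IsMin C a → IsMax C v → a ⊑ v
  min⊑max a-min v-max = proj₁ (Equivalence.from (os _ _) (a-min , v-max))

  a₀ v₀ : Z
  a₀ = proj₁ (proj₁ h1)
  v₀ = proj₁ (proj₂ (proj₁ h1))

  a₀-min : IsMin C a₀
  a₀-min = proj₁ (Equivalence.to (os a₀ v₀) (proj₂ (proj₂ (proj₁ h1))))

  v₀-max : IsMax C v₀
  v₀-max = proj₂ (Equivalence.to (os a₀ v₀) (proj₂ (proj₂ (proj₁ h1))))

  min-max-disjoint : ∀ {z} → IsMin C z → IsMax C z → ⊥
  min-max-disjoint z-min z-max =
    proj₂ (Equivalence.from (os _ v₀) (z-min , v₀-max)) (sym (z-max v₀ (min⊑max z-min v₀-max)))

  min-or-max : ∀ z → IsMin C z ⊎ IsMax C z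
  min-or-max z with any? (λ y → Lt? y z)
  ... | yes (y , y<z) = inj₂ (proj₂ (Equivalence.to (os y z) y<z))
  ... | no ¬below = inj₁ λ y y⊑z → decidable-stable (y ≟ z) (λ y≢z → ¬below (y , y⊑z , y≢z))

  extremal-preserving⇒monotone : (τ : Z → Z) → (∀ {z} → IsMin C z → IsMin C (τ z)) →
                                 (∀ {z} → IsMax C z → IsMax C (τ z)) → Monotone C C τ
  extremal-preserving⇒monotone τ τ-min τ-max z z' z⊑z' with z ≟ z'
  ... | yes refl = ⊑-reflexive refl
  ... | no z≢z' with Equivalence.to (os z z') (z⊑z' , z≢z')
  ...   | z-min , z'-max = min⊑max (τ-min z-min) (τ-max z'-max)

  IsBottom : Subset (size C) → U.Pred Z 0ℓ
  IsBottom S a = IsMin C a × (∀ c → c ∈ S → a ⊑ c)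

  IsTop : Subset (size C) → U.Pred Z 0ℓ
  IsTop S v = IsMax C v × (∀ c → c ∈ S → c ⊑ v)

  IsBottom? : ∀ S → U.Decidable (IsBottom S)
  IsBottom? S a = IsMin? a ×-dec all? (λ c → (c ∈? S) →-dec (a ⊑? c))

  IsTop? : ∀ S → U.Decidable (IsTop S)
  IsTop? S v = IsMax? v ×-dec all? (λ c → (c ∈? S) →-dec (c ⊑? v))

  ∈𝓛⇒∈⋎ : ∀ {S a} → InCalL C S → IsMin C a → a ∈ S → InCurlyVee C a S
  ∈𝓛⇒∈⋎ {S} {a} (a' , _ , N , N≠∅ , N-max , S≡) a-min a∈S
    with x∈p∪q⁻ ⁅ a' ⁆ N (subst (a ∈_) S≡ a∈S)
  ... | inj₁ a∈⁅a'⁆ =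
    subst (λ b → InCurlyVee C b S) (sym (x∈⁅y⁆⇒x≡y a' a∈⁅a'⁆)) (N , N≠∅ , N-max , S≡)
  ... | inj₂ a∈N = ⊥-elim (min-max-disjoint a-min (N-max a a∈N))

  ∈𝓤⇒∈⋏ : ∀ {S v} → InCalU C S → IsMax C v → v ∈ S → InCurlyWedge C v S
  ∈𝓤⇒∈⋏ {S} {v} (v' , _ , N , N≠∅ , N-min , S≡) v-max v∈S
    with x∈p∪q⁻ ⁅ v' ⁆ N (subst (v ∈_) S≡ v∈S)
  ... | inj₁ v∈⁅v'⁆ =
    subst (λ b → InCurlyWedge C b S) (sym (x∈⁅y⁆⇒x≡y v' v∈⁅v'⁆)) (N , N≠∅ , N-min , S≡)
  ... | inj₂ v∈N = ⊥-elim (min-max-disjoint (N-min v v∈N) v-max)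

  ⋎-apex∈ : ∀ {S a} → InCurlyVee C a S → a ∈ S
  ⋎-apex∈ (N , _ , _ , S≡) = subst (_ ∈_) (sym S≡) (x∈p∪q⁺ (inj₁ (x∈⁅x⁆ _)))

  ⋏-apex∈ : ∀ {S v} → InCurlyWedge C v S → v ∈ S
  ⋏-apex∈ (N , _ , _ , S≡) = subst (_ ∈_) (sym S≡) (x∈p∪q⁺ (inj₁ (x∈⁅x⁆ _)))

module _ (P C : FinPoset) where
  private
    X = Fin (size P)
    Z = Fin (size C)

  ExtremalSection : (X → Z) → Set
  ExtremalSection f = Σ (Z → X) λ i →
    (∀ z → f (i z) ≡ z) × (∀ a → IsMin C a → IsMin P (i a)) × (∀ v → IsMax C v → IsMax P (i v))

  MonotoneRetraction : (Z → X) → Set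
  MonotoneRetraction e = ∃[ h ] (Monotone P C h × ∀ z → h (e z) ≡ z)

  surjective⇒extremalSection : HeightOne C → OrdinalSumLU C → ∀ {f} → Monotone P C f →
                               (∀ z → ∃[ x ] f x ≡ z) → ExtremalSection f
  surjective⇒extremalSection h1 os {f} f-mono f-surj =
    (λ z → proj₁ (pick z)) , (λ z → proj₁ (proj₂ (pick z)))
    , (λ a → proj₁ (proj₂ (proj₂ (pick a)))) , (λ v → proj₂ (proj₂ (proj₂ (pick v))))
    where
    open PosetFacts P using (min-below; max-above)
    module C = OrdinalSumFacts C h1 os
    pick : ∀ z → ∃[ x ] (f x ≡ z × (IsMin C z → IsMin P x) × (IsMax C z → IsMax P x))
    pick z with f-surj z | C.min-or-max z
    ... | x , fx≡z | inj₁ z-min =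
      let (a , a-min , a⊑x) = min-below x in
      a , z-min (f a) (subst (_≼_ C (f a)) fx≡z (f-mono a x a⊑x))
        , (λ _ → a-min) , (λ z-max → ⊥-elim (C.min-max-disjoint z-min z-max))
    ... | x , fx≡z | inj₂ z-max =
      let (v , v-max , x⊑v) = max-above x in
      v , z-max (f v) (subst (flip (_≼_ C) (f v)) fx≡z (f-mono x v x⊑v))
        , (λ z-min → ⊥-elim (C.min-max-disjoint z-min z-max)) , (λ _ → v-max)

module SectionToHom (P C : FinPoset) (noIso : NoIsolated P) (h1 : HeightOne C) (os : OrdinalSumLU C)
  {f : Fin (size P) → Fin (size C)} (f-mono : Monotone P C f) (sec : ExtremalSection P C f) where
  private
    X = Fin (size P)
    Z = Fin (size C)
    _⊑_ = _≼_ P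
    _⊑C_ = _≼_ C
  open PosetFacts P using (IsMin?; IsMax?; min-below; max-above; min-max-disjoint)
  module C = OrdinalSumFacts C h1 os
  open PosetFacts C using () renaming (⊑-reflexive to ⊑C-reflexive)

  i : Z → X
  i = proj₁ sec

  private
    section = proj₁ (proj₂ sec)
    i-min = proj₁ (proj₂ (proj₂ sec))
    i-max = proj₂ (proj₂ (proj₂ sec))

  -- The values of g off E(P) do not matter.
  g : X → Z
  g x with IsMin? x | C.min-or-max (f x)
  ... | yes _ | inj₁ _ = f x
  ... | yes _ | inj₂ _ = C.a₀
  ... | no _  | inj₁ _ = C.v₀
  ... | no _  | inj₂ _ = f x

  g-min : ∀ {x} → IsMin P x → IsMin C (g x)
  g-min {x} x-min with IsMin? x | C.min-or-max (f x)
  ... | yes _ | inj₁ fx-min = fx-min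
  ... | yes _ | inj₂ _ = C.a₀-min
  ... | no ¬x-min | _ = ⊥-elim (¬x-min x-min)

  g-max : ∀ {x} → IsMax P x → IsMax C (g x)
  g-max {x} x-max with IsMin? x | C.min-or-max (f x)
  ... | yes x-min | _ = ⊥-elim (min-max-disjoint noIso x-min x-max)
  ... | no _ | inj₁ _ = C.v₀-max
  ... | no _ | inj₂ fx-max = fx-max

  g≡f-min : ∀ {x} → IsMin P x → IsMin C (f x) → g x ≡ f x
  g≡f-min {x} x-min fx-min with IsMin? x | C.min-or-max (f x)
  ... | yes _ | inj₁ _ = refl
  ... | yes _ | inj₂ fx-max = ⊥-elim (C.min-max-disjoint fx-min fx-max)
  ... | no ¬x-min | _ = ⊥-elim (¬x-min x-min)

  g≡f-max : ∀ {x} → IsMax P x → IsMax C (f x) → g x ≡ f x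
  g≡f-max {x} x-max fx-max with IsMin? x | C.min-or-max (f x)
  ... | yes x-min | _ = ⊥-elim (min-max-disjoint noIso x-min x-max)
  ... | no _ | inj₁ fx-min = ⊥-elim (C.min-max-disjoint fx-min fx-max)
  ... | no _ | inj₂ _ = refl

  g-below : ∀ {m x} → IsMin C (f m) → IsMin P x → x ⊑ m → g x ≡ f m
  g-below fm-min x-min x⊑m = trans (g≡f-min x-min (subst (IsMin C) (sym fx≡fm) fm-min)) fx≡fm
    where fx≡fm = fm-min _ (f-mono _ _ x⊑m)

  g-above : ∀ {m y} → IsMax C (f m) → IsMax P y → m ⊑ y → g y ≡ f m
  g-above fm-max y-max m⊑y = trans (g≡f-max y-max (subst (IsMax C) (sym fy≡fm) fm-max)) fy≡fm
    where fy≡fm = fm-max _ (f-mono _ _ m⊑y)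

  module _ {F m} (F≡Ξm : ∀ x → x ∈ F ⇔ Xi P m x) where
    private
      Ξm⊆F : ∀ {x} → Xi P m x → x ∈ F
      Ξm⊆F = Equivalence.from (F≡Ξm _)

    image-Ξ-L : IsMin C (f m) → InCalL C (image g F) × ∃ (C.IsBottom (image g F))
    image-Ξ-L fm-min =
      (f m , fm-min , N , N≠∅ , N-max , ⊆-antisym ⊆-star star-⊆) , f m , fm-min , fm-bottom
      where
      N = image g (F ∩ subsetOf IsMax?)
      N≠∅ : Nonempty N
      N≠∅ = let (v , v-max , m⊑v) = max-above m in
            g v , ∈-image-∩⁺ g IsMax? (Ξm⊆F (inj₂ (v-max , m⊑v))) v-max
      N-max : ∀ c → c ∈ N → IsMax C c
      N-max c c∈N with ∈-image-∩⁻ g IsMax? c∈N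
      ... | x , (_ , x-max) , refl = g-max x-max
      ⊆-star : ∀ {c} → c ∈ image g F → c ∈ ⁅ f m ⁆ ∪ N
      ⊆-star c∈ with ∈-image⁻ g c∈
      ... | x , x∈F , refl with Equivalence.to (F≡Ξm x) x∈F
      ...   | inj₁ (x-min , x⊑m) =
        x∈p∪q⁺ (inj₁ (subst (_∈ ⁅ f m ⁆) (sym (g-below fm-min x-min x⊑m)) (x∈⁅x⁆ _)))
      ...   | inj₂ (x-max , _) = x∈p∪q⁺ (inj₂ (∈-image-∩⁺ g IsMax? x∈F x-max))
      star-⊆ : ∀ {c} → c ∈ ⁅ f m ⁆ ∪ N → c ∈ image g F
      star-⊆ c∈ with x∈p∪q⁻ ⁅ f m ⁆ N c∈
      ... | inj₁ c∈⁅fm⁆ =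
        let (a , a-min , a⊑m) = min-below m in
        subst (_∈ image g F) (trans (g-below fm-min a-min a⊑m) (sym (x∈⁅y⁆⇒x≡y _ c∈⁅fm⁆)))
              (∈-image⁺ g (Ξm⊆F (inj₁ (a-min , a⊑m))))
      ... | inj₂ c∈N with ∈-image-∩⁻ g IsMax? c∈N
      ...   | x , (x∈F , _) , refl = ∈-image⁺ g x∈F
      fm-bottom : ∀ c → c ∈ image g F → f m ⊑C c
      fm-bottom c c∈ with ∈-image⁻ g c∈
      ... | x , x∈F , refl with Equivalence.to (F≡Ξm x) x∈F
      ...   | inj₁ (x-min , x⊑m) = ⊑C-reflexive (sym (g-below fm-min x-min x⊑m))
      ...   | inj₂ (x-max , _) = C.min⊑max fm-min (g-max x-max)

    image-Ξ-U : IsMax C (f m) → InCalU C (image g F) × ∃ (C.IsTop (image g F))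
    image-Ξ-U fm-max =
      (f m , fm-max , N , N≠∅ , N-min , ⊆-antisym ⊆-star star-⊆) , f m , fm-max , fm-top
      where
      N = image g (F ∩ subsetOf IsMin?)
      N≠∅ : Nonempty N
      N≠∅ = let (a , a-min , a⊑m) = min-below m in
            g a , ∈-image-∩⁺ g IsMin? (Ξm⊆F (inj₁ (a-min , a⊑m))) a-min
      N-min : ∀ c → c ∈ N → IsMin C c
      N-min c c∈N with ∈-image-∩⁻ g IsMin? c∈N
      ... | x , (_ , x-min) , refl = g-min x-min
      ⊆-star : ∀ {c} → c ∈ image g F → c ∈ ⁅ f m ⁆ ∪ N
      ⊆-star c∈ with ∈-image⁻ g c∈
      ... | x , x∈F , refl with Equivalence.to (F≡Ξm x) x∈F
      ...   | inj₂ (x-max , m⊑x) =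
        x∈p∪q⁺ (inj₁ (subst (_∈ ⁅ f m ⁆) (sym (g-above fm-max x-max m⊑x)) (x∈⁅x⁆ _)))
      ...   | inj₁ (x-min , _) = x∈p∪q⁺ (inj₂ (∈-image-∩⁺ g IsMin? x∈F x-min))
      star-⊆ : ∀ {c} → c ∈ ⁅ f m ⁆ ∪ N → c ∈ image g F
      star-⊆ c∈ with x∈p∪q⁻ ⁅ f m ⁆ N c∈
      ... | inj₁ c∈⁅fm⁆ =
        let (v , v-max , m⊑v) = max-above m in
        subst (_∈ image g F) (trans (g-above fm-max v-max m⊑v) (sym (x∈⁅y⁆⇒x≡y _ c∈⁅fm⁆)))
              (∈-image⁺ g (Ξm⊆F (inj₂ (v-max , m⊑v))))
      ... | inj₂ c∈N with ∈-image-∩⁻ g IsMin? c∈N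
      ...   | x , (x∈F , _) , refl = ∈-image⁺ g x∈F
      fm-top : ∀ c → c ∈ image g F → c ⊑C f m
      fm-top c c∈ with ∈-image⁻ g c∈
      ... | x , x∈F , refl with Equivalence.to (F≡Ξm x) x∈F
      ...   | inj₂ (x-max , m⊑x) = ⊑C-reflexive (g-above fm-max x-max m⊑x)
      ...   | inj₁ (x-min , _) = C.min⊑max (g-min x-min) fm-max

  image-Ξ∈C0 : ∀ {F m} → (∀ x → x ∈ F ⇔ Xi P m x) → InC0 C (image g F)
  image-Ξ∈C0 {m = m} F≡Ξm with C.min-or-max (f m)
  ... | inj₁ fm-min = inj₁ (image-Ξ-L F≡Ξm fm-min)
  ... | inj₂ fm-max = inj₂ (image-Ξ-U F≡Ξm fm-max)

  hom : IsHom P C (image g)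
  hom = (λ { F (m , _ , F≡Ξm , _) → image-Ξ∈C0 F≡Ξm })
      , (λ { F G _ _ (x , x-min , x∈F , x∈G) →
               g x , g-min x-min , ∈-image⁺ g x∈F , ∈-image⁺ g x∈G })
      , (λ { F G _ _ (x , x-max , x∈F , x∈G) →
               g x , g-max x-max , ∈-image⁺ g x∈F , ∈-image⁺ g x∈G })

  belongs : Belongs P C (image g) i
  belongs = i-injective , i-min , i-max
          , (λ a F a-min _ ia∈F φF∈𝓛 →
               C.∈𝓛⇒∈⋎ φF∈𝓛 a-min (subst (_∈ image g F) (g∘i-min a-min) (∈-image⁺ g ia∈F)))
          , (λ v F v-max _ iv∈F φF∈𝓤 →
               C.∈𝓤⇒∈⋏ φF∈𝓤 v-max (subst (_∈ image g F) (g∘i-max v-max) (∈-image⁺ g iv∈F)))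
    where
    i-injective : ∀ {z z'} → i z ≡ i z' → z ≡ z'
    i-injective {z} {z'} iz≡iz' = trans (sym (section z)) (trans (cong f iz≡iz') (section z'))
    g∘i-min : ∀ {a} → IsMin C a → g (i a) ≡ a
    g∘i-min {a} a-min =
      trans (g≡f-min (i-min a a-min) (subst (IsMin C) (sym (section a)) a-min)) (section a)
    g∘i-max : ∀ {v} → IsMax C v → g (i v) ≡ v
    g∘i-max {v} v-max =
      trans (g≡f-max (i-max v v-max) (subst (IsMax C) (sym (section v)) v-max)) (section v)

module HomToSection (P C : FinPoset) (noIso : NoIsolated P) (h1 : HeightOne C) (os : OrdinalSumLU C)
  {φ : Subset (size P) → Subset (size C)} (hom : IsHom P C φ)
  {i : Fin (size C) → Fin (size P)} (bel : Belongs P C φ i) where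
  private
    X = Fin (size P)
    Z = Fin (size C)
    _⊑_ = _≼_ P
    _⊑C_ = _≼_ C
  open PosetFacts P
  module C = OrdinalSumFacts C h1 os
  open PosetFacts C using () renaming (IsMin? to IsMinC?; IsMax? to IsMaxC?; ⊑-reflexive to ⊑C-reflexive)

  i-min : ∀ a → IsMin C a → IsMin P (i a)
  i-min = proj₁ (proj₂ bel)

  i-max : ∀ v → IsMax C v → IsMax P (i v)
  i-max = proj₁ (proj₂ (proj₂ bel))

  private
    φ∈C0 = proj₁ hom
    φ-L-edge = proj₁ (proj₂ hom)
    φ-U-edge = proj₂ (proj₂ hom)
    i-injective = proj₁ bel
    separatesᴸ = proj₁ (proj₂ (proj₂ (proj₂ bel)))
    separatesᵁ = proj₂ (proj₂ (proj₂ (proj₂ bel)))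

  BundleBottom : X → U.Pred Z 0ℓ
  BundleBottom x a = ∃[ F ] (InF P F × x ∈ F × C.IsBottom (φ F) a)

  BundleTop : X → U.Pred Z 0ℓ
  BundleTop y v = ∃[ F ] (InF P F × y ∈ F × C.IsTop (φ F) v)

  BundleBottom? : ∀ x → U.Decidable (BundleBottom x)
  BundleBottom? x a = anySubset? (λ F → InF? F ×-dec (x ∈? F) ×-dec C.IsBottom? (φ F) a)

  BundleTop? : ∀ y → U.Decidable (BundleTop y)
  BundleTop? y v = anySubset? (λ F → InF? F ×-dec (y ∈? F) ×-dec C.IsTop? (φ F) v)

  minPreimage? : ∀ x → Dec (∃[ a ] (IsMin C a × i a ≡ x))
  minPreimage? x = any? (λ a → IsMinC? a ×-dec (i a ≟ x))

  maxPreimage? : ∀ y → Dec (∃[ v ] (IsMax C v × i v ≡ y))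
  maxPreimage? y = any? (λ v → IsMaxC? v ×-dec (i v ≟ y))

  labelᴸ : X → Z
  labelᴸ x with minPreimage? x | any? (BundleBottom? x)
  ... | yes (a , _) | _ = a
  ... | no _ | yes (a , _) = a
  ... | no _ | no _ = C.a₀

  labelᵁ : X → Z
  labelᵁ y with maxPreimage? y | any? (BundleTop? y)
  ... | yes (v , _) | _ = v
  ... | no _ | yes (v , _) = v
  ... | no _ | no _ = C.v₀

  labelᴸ-min : ∀ x → IsMin C (labelᴸ x)
  labelᴸ-min x with minPreimage? x | any? (BundleBottom? x)
  ... | yes (_ , a-min , _) | _ = a-min
  ... | no _ | yes (_ , _ , _ , _ , a-min , _) = a-min
  ... | no _ | no _ = C.a₀-min

  labelᵁ-max : ∀ y → IsMax C (labelᵁ y)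
  labelᵁ-max y with maxPreimage? y | any? (BundleTop? y)
  ... | yes (_ , v-max , _) | _ = v-max
  ... | no _ | yes (_ , _ , _ , _ , v-max , _) = v-max
  ... | no _ | no _ = C.v₀-max

  labelᴸ∘i : ∀ {a} → IsMin C a → labelᴸ (i a) ≡ a
  labelᴸ∘i {a} a-min with minPreimage? (i a) | any? (BundleBottom? (i a))
  ... | yes (_ , _ , ia'≡ia) | _ = i-injective ia'≡ia
  ... | no none | _ = ⊥-elim (none (a , a-min , refl))

  labelᵁ∘i : ∀ {v} → IsMax C v → labelᵁ (i v) ≡ v
  labelᵁ∘i {v} v-max with maxPreimage? (i v) | any? (BundleTop? (i v))
  ... | yes (_ , _ , iv'≡iv) | _ = i-injective iv'≡iv
  ... | no none | _ = ⊥-elim (none (v , v-max , refl))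

  -- Separation settles the points of i[L(C)], and L-edges the others.
  labelᴸ-bundle : ∀ {F x a} → InF P F → x ∈ F → IsMin P x →
                  InCalL C (φ F) → C.IsBottom (φ F) a → labelᴸ x ≡ a
  labelᴸ-bundle {F} {x} {a} F∈𝓕 x∈F x-min φF∈𝓛 (a-min , a-bottom)
    with minPreimage? x | any? (BundleBottom? x)
  ... | yes (a' , a'-min , refl) | _ =
    sym (a'-min a (a-bottom a' (C.⋎-apex∈ (separatesᴸ a' F a'-min F∈𝓕 x∈F φF∈𝓛))))
  ... | no _ | yes (a' , F' , F'∈𝓕 , x∈F' , _ , a'-bottom) =
    let (c , c-min , c∈φF' , c∈φF) = φ-L-edge F' F F'∈𝓕 F∈𝓕 (x , x-min , x∈F' , x∈F) in
    trans (c-min a' (a'-bottom c c∈φF')) (sym (c-min a (a-bottom c c∈φF)))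
  ... | no _ | no none = ⊥-elim (none (a , F , F∈𝓕 , x∈F , a-min , a-bottom))

  labelᵁ-bundle : ∀ {F y v} → InF P F → y ∈ F → IsMax P y →
                  InCalU C (φ F) → C.IsTop (φ F) v → labelᵁ y ≡ v
  labelᵁ-bundle {F} {y} {v} F∈𝓕 y∈F y-max φF∈𝓤 (v-max , v-top)
    with maxPreimage? y | any? (BundleTop? y)
  ... | yes (v' , v'-max , refl) | _ =
    sym (v'-max v (v-top v' (C.⋏-apex∈ (separatesᵁ v' F v'-max F∈𝓕 y∈F φF∈𝓤))))
  ... | no _ | yes (v' , F' , F'∈𝓕 , y∈F' , _ , v'-top) =
    let (c , c-max , c∈φF' , c∈φF) = φ-U-edge F' F F'∈𝓕 F∈𝓕 (y , y-max , y∈F' , y∈F) in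
    trans (c-max v' (v'-top c c∈φF')) (sym (c-max v (v-top c c∈φF)))
  ... | no _ | no none = ⊥-elim (none (v , F , F∈𝓕 , y∈F , v-max , v-top))

  ¬split-both-ways : ∀ {m} → SplitsBelow labelᴸ m → ¬ SplitsAbove labelᵁ m
  ¬split-both-ways {m} below@(x , x' , (x-min , x⊑m) , (x'-min , x'⊑m) , ℓx≢ℓx')
                       above@(y , y' , (y-max , m⊑y) , (y'-max , m⊑y') , ℓy≢ℓy') =
    star-identifies-pair (φ∈C0 F F∈𝓕)
    where
    bundle : ∃[ F ] (InF P F × ∀ x → Xi P m x → x ∈ F)
    bundle = InM⇒bundle (splits⇒InM noIso below above)
    F = proj₁ bundle
    F∈𝓕 = proj₁ (proj₂ bundle)
    Ξm⊆F = proj₂ (proj₂ bundle)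
    star-identifies-pair : InC0 C (φ F) → ⊥
    star-identifies-pair (inj₁ (φF∈𝓛 , _ , a-bottom)) =
      ℓx≢ℓx' (trans (labelᴸ-bundle F∈𝓕 (Ξm⊆F x (inj₁ (x-min , x⊑m))) x-min φF∈𝓛 a-bottom)
             (sym (labelᴸ-bundle F∈𝓕 (Ξm⊆F x' (inj₁ (x'-min , x'⊑m))) x'-min φF∈𝓛 a-bottom)))
    star-identifies-pair (inj₂ (φF∈𝓤 , _ , v-top)) =
      ℓy≢ℓy' (trans (labelᵁ-bundle F∈𝓕 (Ξm⊆F y (inj₂ (y-max , m⊑y))) y-max φF∈𝓤 v-top)
             (sym (labelᵁ-bundle F∈𝓕 (Ξm⊆F y' (inj₂ (y'-max , m⊑y'))) y'-max φF∈𝓤 v-top)))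

  ⌊_⌋ ⌈_⌉ : X → X
  ⌊ m ⌋ = proj₁ (min-below m)
  ⌈ m ⌉ = proj₁ (max-above m)

  ⌊⌋-min : ∀ m → IsMin P ⌊ m ⌋
  ⌊⌋-min m = proj₁ (proj₂ (min-below m))

  ⌊⌋⊑ : ∀ m → ⌊ m ⌋ ⊑ m
  ⌊⌋⊑ m = proj₂ (proj₂ (min-below m))

  ⌈⌉-max : ∀ m → IsMax P ⌈ m ⌉
  ⌈⌉-max m = proj₁ (proj₂ (max-above m))

  ⊑⌈⌉ : ∀ m → m ⊑ ⌈ m ⌉
  ⊑⌈⌉ m = proj₂ (proj₂ (max-above m))

  choose : ∀ {m} → Dec (IsMax P m) → Dec (SplitsBelow labelᴸ m) → Z
  choose {m} (yes _) _ = labelᵁ m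
  choose {m} (no _) (yes _) = labelᵁ ⌈ m ⌉
  choose {m} (no _) (no _) = labelᴸ ⌊ m ⌋

  f : X → Z
  f m = choose (IsMax? m) (SplitsBelow? labelᴸ m)

  choose-mono : ∀ {x y} → x ⊑ y →
                (x-max? : Dec (IsMax P x)) (x-split? : Dec (SplitsBelow labelᴸ x)) →
                (y-max? : Dec (IsMax P y)) (y-split? : Dec (SplitsBelow labelᴸ y)) →
                choose x-max? x-split? ⊑C choose y-max? y-split?
  choose-mono {x} {y} x⊑y (yes x-max) _ (yes _) _ = ⊑C-reflexive (cong labelᵁ (sym (x-max y x⊑y)))
  choose-mono {x} {y} x⊑y (yes x-max) _ (no ¬y-max) _ =
    ⊥-elim (¬y-max (subst (IsMax P) (sym (x-max y x⊑y)) x-max))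
  choose-mono {x} {y} x⊑y (no _) (yes x-split) (yes y-max) _ =
    ⊑C-reflexive (¬SplitsAbove⇒const labelᵁ (¬split-both-ways x-split)
                   (⌈⌉-max x) (⊑⌈⌉ x) y-max x⊑y)
  choose-mono {x} {y} x⊑y (no _) (yes x-split) (no _) (yes _) =
    ⊑C-reflexive (¬SplitsAbove⇒const labelᵁ (¬split-both-ways x-split)
                   (⌈⌉-max x) (⊑⌈⌉ x) (⌈⌉-max y) (⊑-trans x⊑y (⊑⌈⌉ y)))
  choose-mono x⊑y (no _) (yes x-split) (no _) (no ¬y-split) =
    ⊥-elim (¬y-split (SplitsBelow-mono labelᴸ x⊑y x-split))
  choose-mono {x} {y} x⊑y (no _) (no _) (yes _) _ = C.min⊑max (labelᴸ-min ⌊ x ⌋) (labelᵁ-max y)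
  choose-mono {x} {y} x⊑y (no _) (no _) (no _) (yes _) =
    C.min⊑max (labelᴸ-min ⌊ x ⌋) (labelᵁ-max ⌈ y ⌉)
  choose-mono {x} {y} x⊑y (no _) (no _) (no _) (no ¬y-split) =
    ⊑C-reflexive (¬SplitsBelow⇒const labelᴸ ¬y-split
                   (⌊⌋-min x) (⊑-trans (⌊⌋⊑ x) x⊑y) (⌊⌋-min y) (⌊⌋⊑ y))

  f-mono : Monotone P C f
  f-mono x y x⊑y = choose-mono x⊑y (IsMax? x) (SplitsBelow? labelᴸ x) (IsMax? y) (SplitsBelow? labelᴸ y)

  choose-section : ∀ {z} → IsMin C z ⊎ IsMax C z →
                   (iz-max? : Dec (IsMax P (i z))) (iz-split? : Dec (SplitsBelow labelᴸ (i z))) →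
                   choose iz-max? iz-split? ≡ z
  choose-section {z} (inj₁ z-min) (yes iz-max) _ = ⊥-elim (min-max-disjoint noIso (i-min z z-min) iz-max)
  choose-section {z} (inj₁ z-min) (no _) (yes split) =
    ⊥-elim (min⇒¬SplitsBelow labelᴸ (i-min z z-min) split)
  choose-section {z} (inj₁ z-min) (no _) (no _) =
    trans (cong labelᴸ (i-min z z-min ⌊ i z ⌋ (⌊⌋⊑ (i z)))) (labelᴸ∘i z-min)
  choose-section (inj₂ z-max) (yes _) _ = labelᵁ∘i z-max
  choose-section {z} (inj₂ z-max) (no ¬iz-max) _ = ⊥-elim (¬iz-max (i-max z z-max))

  f∘i : ∀ z → f (i z) ≡ z
  f∘i z = choose-section (C.min-or-max z) (IsMax? (i z)) (SplitsBelow? labelᴸ (i z))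

module InducedSubposet (P C : FinPoset) (noIso : NoIsolated P) (h1 : HeightOne C) (os : OrdinalSumLU C)
  {e : Fin (size C) → Fin (size P)} (e-ext : ∀ z → IsExt P (e z)) (e-emb : InducedEmbedding P C e) where
  private
    X = Fin (size P)
    Z = Fin (size C)
    e-injective : ∀ {z z'} → e z ≡ e z' → z ≡ z'
    e-injective = proj₁ e-emb
    e-mono : ∀ {z z'} → _≼_ C z z' → _≼_ P (e z) (e z')
    e-mono = Equivalence.to (proj₂ e-emb _ _)
    e-reflects : ∀ {z z'} → _≼_ P (e z) (e z') → _≼_ C z z'
    e-reflects = Equivalence.from (proj₂ e-emb _ _)
  module C = OrdinalSumFacts C h1 os
  open PosetFacts P using (min-max-disjoint)

  e-min : ∀ a → IsMin C a → IsMin P (e a)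
  e-min a a-min with e-ext a
  ... | inj₁ ea-min = ea-min
  ... | inj₂ ea-max = ⊥-elim (C.min-max-disjoint a-min (subst (IsMax C) v₀≡a C.v₀-max))
    where v₀≡a = e-injective (ea-max _ (e-mono (C.min⊑max a-min C.v₀-max)))

  e-max : ∀ v → IsMax C v → IsMax P (e v)
  e-max v v-max with e-ext v
  ... | inj₂ ev-max = ev-max
  ... | inj₁ ev-min = ⊥-elim (C.min-max-disjoint (subst (IsMin C) a₀≡v C.a₀-min) v-max)
    where a₀≡v = e-injective (ev-min _ (e-mono (C.min⊑max C.a₀-min v-max)))

  IsRetractVia⇔MonotoneRetraction : IsRetractVia P C e ⇔ MonotoneRetraction P C e
  IsRetractVia⇔MonotoneRetraction = mk⇔ to from
    where
    to : IsRetractVia P C e → MonotoneRetraction P C e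
    to (r , r-mono , r-idem , r⊆e , e⊆r) = h , h-mono , h∘e
      where
      h : X → Z
      h x = proj₁ (r⊆e x)
      r≡e∘h : ∀ x → r x ≡ e (h x)
      r≡e∘h x = proj₂ (r⊆e x)
      h-mono : Monotone P C h
      h-mono x y x⊑y = e-reflects (subst₂ (_≼_ P) (r≡e∘h x) (r≡e∘h y) (r-mono x y x⊑y))
      r-fixes-e : ∀ z → r (e z) ≡ e z
      r-fixes-e z = let (x , rx≡ez) = e⊆r z in
        trans (cong r (sym rx≡ez)) (trans (r-idem x) rx≡ez)
      h∘e : ∀ z → h (e z) ≡ z
      h∘e z = e-injective (trans (sym (r≡e∘h (e z))) (r-fixes-e z))
    from : MonotoneRetraction P C e → IsRetractVia P C e
    from (h , h-mono , h∘e) =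
      e ∘ h , (λ x y x⊑y → e-mono (h-mono x y x⊑y)) , (λ x → cong e (h∘e (h x)))
      , (λ x → h x , refl) , (λ z → e z , cong e (h∘e z))

  -- i[Z] = e[Z] makes i = e ∘ τ for a permutation τ of Z preserving L(C) and U(C).
  reindexed-section⇒retraction : ∀ {f : X → Z} {i : Z → X} →
    Monotone P C f → (∀ z → f (i z) ≡ z) →
    (∀ a → IsMin C a → IsMin P (i a)) → (∀ v → IsMax C v → IsMax P (i v)) →
    (∀ z → ∃[ z' ] i z ≡ e z') → (∀ z → ∃[ z' ] i z' ≡ e z) → MonotoneRetraction P C e
  reindexed-section⇒retraction {f} {i} f-mono f∘i i-min i-max i⊆e e⊆i = τ ∘ f , τ∘f-mono , τ∘f∘e
    where
    τ : Z → Z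
    τ z = proj₁ (i⊆e z)
    i≡e∘τ : ∀ z → i z ≡ e (τ z)
    i≡e∘τ z = proj₂ (i⊆e z)
    τ-min : ∀ {z} → IsMin C z → IsMin C (τ z)
    τ-min {z} z-min with C.min-or-max (τ z)
    ... | inj₁ τz-min = τz-min
    ... | inj₂ τz-max =
      ⊥-elim (min-max-disjoint noIso (i-min z z-min) (subst (IsMax P) (sym (i≡e∘τ z)) (e-max _ τz-max)))
    τ-max : ∀ {z} → IsMax C z → IsMax C (τ z)
    τ-max {z} z-max with C.min-or-max (τ z)
    ... | inj₂ τz-max = τz-max
    ... | inj₁ τz-min =
      ⊥-elim (min-max-disjoint noIso (subst (IsMin P) (sym (i≡e∘τ z)) (e-min _ τz-min)) (i-max z z-max))
    τ∘f-mono : Monotone P C (τ ∘ f)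
    τ∘f-mono x y x⊑y = C.extremal-preserving⇒monotone τ τ-min τ-max _ _ (f-mono x y x⊑y)
    τ∘f∘e : ∀ w → τ (f (e w)) ≡ w
    τ∘f∘e w = let (z , iz≡ew) = e⊆i w in begin
      τ (f (e w)) ≡⟨ cong (τ ∘ f) (sym iz≡ew) ⟩
      τ (f (i z)) ≡⟨ cong τ (f∘i z) ⟩
      τ z         ≡⟨ e-injective (trans (sym (i≡e∘τ z)) iz≡ew) ⟩
      w           ∎
      where open ≡-Reasoning

-- The hypothesis 2 ≤ size P is unused: NoIsolated P already excludes the one-point poset.
theorem1 : (P C : FinPoset) → 2 ≤ size P → NoIsolated P
    → HeightOne C → OrdinalSumLU C
    → (SurjectiveMonotone P C ⇔ (∃[ φ ] (IsHom P C φ × Separating P C φ)))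
      × ((e : Fin (size C) → Fin (size P)) → (∀ z → IsExt P (e z))
         → InducedEmbedding P C e
         → (IsRetractVia P C e ⇔ (∃[ φ ] (IsHom P C φ × ZSeparating P C e φ))))
theorem1 P C _ noIso h1 os = mk⇔ surjective⇒hom hom⇒surjective , retract⇔hom
  where
  surjective⇒hom : SurjectiveMonotone P C → ∃[ φ ] (IsHom P C φ × Separating P C φ)
  surjective⇒hom (f , f-mono , f-surj) = image g , hom , i , belongs
    where open SectionToHom P C noIso h1 os f-mono (surjective⇒extremalSection P C h1 os f-mono f-surj)

  hom⇒surjective : ∃[ φ ] (IsHom P C φ × Separating P C φ) → SurjectiveMonotone P C
  hom⇒surjective (φ , φ-hom , i , i-belongs) = f , f-mono , λ z → i z , f∘i z
    where open HomToSection P C noIso h1 os φ-hom i-belongs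

  retract⇔hom : (e : Fin (size C) → Fin (size P)) → (∀ z → IsExt P (e z)) → InducedEmbedding P C e
                → IsRetractVia P C e ⇔ (∃[ φ ] (IsHom P C φ × ZSeparating P C e φ))
  retract⇔hom e e-ext e-emb = mk⇔ retract⇒hom hom⇒retract
    where
    open InducedSubposet P C noIso h1 os e-ext e-emb
    retract⇒hom : IsRetractVia P C e → ∃[ φ ] (IsHom P C φ × ZSeparating P C e φ)
    retract⇒hom r with Equivalence.to IsRetractVia⇔MonotoneRetraction r
    ... | h , h-mono , h∘e = image g , hom , e-ext , e , belongs , (λ z → z , refl) , (λ z → z , refl)
      where open SectionToHom P C noIso h1 os h-mono (e , h∘e , e-min , e-max)
    hom⇒retract : ∃[ φ ] (IsHom P C φ × ZSeparating P C e φ) → IsRetractVia P C e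
    hom⇒retract (φ , φ-hom , _ , i , i-belongs , i⊆e , e⊆i) =
      Equivalence.from IsRetractVia⇔MonotoneRetraction
        (reindexed-section⇒retraction f-mono f∘i i-min i-max i⊆e e⊆i)
      where open HomToSection P C noIso h1 os φ-hom i-belongs
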